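{- Let $(T,\lambda)$ be an edge-labeled phylogenetic tree and let $e$ and $f$ be two edges of $T$ such that $(T,\lambda)$, $(T_e,\lambda_e)$ and $(T_f,\lambda_f)$ explain the same relation $\mathcal{X}$. Then the tree $((T_e)_f,(\lambda_e)_f)$, obtained from $(T_e,\lambda_e)$ by contracting the edge $f$, also explains $\mathcal{X}$.
   Context: Phylogenetic tree: rooted tree, root degree $\ge2$, other inner vertices degree $\ge3$. $\lambda:E\to\{0,1\}$. $\mathcal{X}_{(T,\lambda)}$: $(x,y)$ for distinct leaves with a 1-edge on the path from $\operatorname{lca}(x,y)$ to $y$; explains means $\mathcal{X}=\mathcal{X}_{(T,\lambda)}$. $(T_e,\lambda_e)$ denotes the extended contraction of $e$: contract $e$ keeping other labels; if $e=(u,v)$ is an outer edge, the leaf $v$ is lost and additionally a resulting root $u$ of degree $1$ is deleted (its child becoming the root), or a resulting non-root vertex $u$ of degree $2$ with parent $w$ and child $w'$ is suppressed by replacing $w,u,w'$ with an edge $(w,w')$ labeled $1$ iff one of $(w,u),(u,w')$ was labeled $1$. -}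

module Defs where

open import Data.Nat using (ℕ; _≡ᵇ_; _≤_)
open import Data.Bool using (Bool; true; false; _∨_; if_then_else_)
open import Data.List using (List; []; _∷_; _++_; length)
open import Data.List.Relation.Unary.Any using (Any)
open import Data.List.Relation.Unary.All using (All)
open import Data.List.Relation.Unary.Unique.Propositional using (Unique)
open import Data.Product using (_×_; _,_; proj₁; proj₂; Σ)
open import Data.Sum using (_⊎_)
open import Relation.Binary.PropositionalEquality using (_≡_)
open import Function.Bundles using (_⇔_)
open import Data.List.Membership.Propositional using (_∈_)

-- A vertex is  node v cs  where v : ℕ is its identifier and cs is the
-- list of its children, each paired with the label (true = 1, false = 0)
-- of the edge from v to that child.  A leaf is a vertex without children;
-- its identifier is its name.  An edge (u,v) is identified by the
-- identifier of its child endpoint v.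

data Tree : Set where
  node : ℕ → List (Bool × Tree) → Tree

Edge : Set
Edge = Bool × Tree

mutual
  ids : Tree → List ℕ
  ids (node v cs) = v ∷ idsL cs

  idsL : List Edge → List ℕ
  idsL [] = []
  idsL ((_ , c) ∷ cs) = ids c ++ idsL cs

-- every non-root inner vertex has at least 2 children (degree ≥ 3)
data InnerOK : Tree → Set where
  inner-ok : ∀ {v cs} → (length cs ≡ 0 ⊎ 2 ≤ length cs) →
             All (λ p → InnerOK (proj₂ p)) cs → InnerOK (node v cs)

Phylogenetic : Tree → Set
Phylogenetic (node v cs) =
  Unique (ids (node v cs)) ×
  (length cs ≡ 0 ⊎ 2 ≤ length cs) ×
  All (λ p → InnerOK (proj₂ p)) cs

data LeafIn (x : ℕ) : Tree → Set where
  here  : LeafIn x (node x [])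
  there : ∀ {u cs} → Any (λ p → LeafIn x (proj₂ p)) cs → LeafIn x (node u cs)

mutual
  data OnePath (y : ℕ) : Tree → Set where
    step : ∀ {u cs} → Any (OneVia y) cs → OnePath y (node u cs)

  OneVia : ℕ → Edge → Set
  OneVia y (b , c) = LeafIn y c × (b ≡ true ⊎ OnePath y c)

-- (x , y) ∈ 𝒳_(T,λ): x and y are leaves in different child subtrees of
-- a vertex u (so u = lca(x,y) and x ≠ y) and the path from u to y
-- contains an edge labelled 1.
SplitAt : ℕ → ℕ → Edge → Edge → Set
SplitAt x y a b = LeafIn x (proj₂ a) × OneVia y b

data Rel : Tree → ℕ → ℕ → Set where
  inside : ∀ {u cs x y} → Any (λ p → Rel (proj₂ p) x y) cs → Rel (node u cs) x y
  split  : ∀ {u cs x y} (pre mid post : List Edge) (a b : Edge) →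
           cs ≡ pre ++ (a ∷ mid ++ (b ∷ post)) →
           (SplitAt x y a b ⊎ SplitAt x y b a) →
           Rel (node u cs) x y

Explains : Tree → (ℕ → ℕ → Set) → Set
Explains T X = ∀ x y → X x y ⇔ Rel T x y

IsEdge : ℕ → Tree → Set
IsEdge e (node u cs) = e ∈ idsL cs

data Step : Set where
  -- t was a leaf child of u; it was removed; remaining children given
  removedLeaf : List Edge → Step
  other       : List Edge → Step

mutual
  stepL : ℕ → List Edge → Step
  stepL t [] = other []
  stepL t ((b , node v []) ∷ rest) =
    if v ≡ᵇ t then removedLeaf rest else cons (b , node v []) (stepL t rest)
  stepL t ((b , node v (d ∷ ds)) ∷ rest) =
    if v ≡ᵇ t
    then other ((d ∷ ds) ++ rest)                       -- inner edge: children of v move to u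
    else cons (edgeC t b v (d ∷ ds)) (stepL t rest)

  -- process the edge labelled a into the non-root vertex  node u cs ;
  -- suppresses u if it lost a leaf child and now has a single child
  edgeC : ℕ → Bool → ℕ → List Edge → Edge
  edgeC t a u cs with stepL t cs
  ... | removedLeaf ((b , c) ∷ []) = (a ∨ b , c)
  ... | removedLeaf r = (a , node u r)
  ... | other r = (a , node u r)

  cons : Edge → Step → Step
  cons e (removedLeaf r) = removedLeaf (e ∷ r)
  cons e (other r) = other (e ∷ r)

contract : ℕ → Tree → Tree
contract t (node u cs) with stepL t cs
... | removedLeaf ((b , c) ∷ []) = c                   -- root of degree 1 deleted
... | removedLeaf r = node u r
... | other r = node u r

module Submission where

-- The proof rests on a characterisation of 𝒳_(T,λ) (Section 3): (x,y) is
-- in the relation iff x is a leaf of T and some 1-edge of T has y but not x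
-- below it (a "separation" of (x,y)).  Section 4 studies the extended
-- contraction of a single edge t: it keeps the tree phylogenetic, removes
-- t, keeps all leaves except t, every 1-edge of T_t comes from a 1-edge of
-- T whose child is not t, and every such 1-edge of T survives in T_t, with
-- the same leaves below it up to t.  Hence (Section 5) a separation in T_t
-- pulls back to a separation in T avoiding t, and one avoiding t pushes
-- forward to T_t.  Section 6 is the geometric heart: if T and T_t explain
-- the same relation and the 1-edge into t separates some y, then a deeper
-- 1-edge does too; from this we find, for each (x,y) ∈ 𝒳, a separation in
-- T avoiding both e and f.  If e is a leaf, 𝒳 is empty; otherwise this
-- separation survives both contractions, proving the lemma (Section 7).

open import Defs
open import Data.Nat using (ℕ; suc; _≡ᵇ_; _≤_; _≟_; z≤n; s≤s)
open import Data.Nat.Properties using (≡ᵇ⇒≡; ≡⇒≡ᵇ; ≤-trans; m≤n+m)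
open import Data.Bool using (true; false; _∨_; T)
open import Data.List using (List; []; _∷_; _++_; length)
open import Data.List.Properties using (length-++; ++-identityʳ; ++-assoc)
open import Data.List.Relation.Unary.Any using (Any; here; there)
import Data.List.Relation.Unary.Any.Properties as Any
open import Data.List.Relation.Unary.All using (All; []; _∷_; lookup)
import Data.List.Relation.Unary.All.Properties as All
open import Data.List.Relation.Unary.AllPairs using ([]; _∷_)
open import Data.List.Relation.Unary.Unique.Propositional using (Unique)
open import Data.List.Relation.Binary.Sublist.Propositional using (_⊆_; []; _∷_; _∷ʳ_; ⊆-refl)
import Data.List.Relation.Binary.Sublist.Propositional.Properties as Sublist
open import Data.List.Membership.Propositional using (_∈_; _∉_; find)
open import Data.List.Membership.Propositional.Properties using (∈-++⁺ˡ; ∈-++⁺ʳ; ∈-++⁻; ∈-∃++)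
open import Data.Product using (_×_; _,_; proj₁; proj₂; Σ)
open import Data.Sum using (_⊎_; inj₁; inj₂; map₂)
open import Data.Empty using (⊥; ⊥-elim)
open import Data.Unit using (⊤; tt)
open import Relation.Binary.PropositionalEquality using (_≡_; _≢_; refl; sym; trans; cong; subst)
open import Relation.Nullary using (¬_; yes; no)
open import Function.Bundles using (Equivalence; mk⇔)

unique-⊆ : ∀ {xs ys : List ℕ} → xs ⊆ ys → Unique ys → Unique xs
unique-⊆ [] u = u
unique-⊆ (_ ∷ʳ p) (_ ∷ u) = unique-⊆ p u
unique-⊆ (refl ∷ p) (a ∷ u) = Sublist.All-resp-⊆ p a ∷ unique-⊆ p u

unique-++ˡ : ∀ (xs : List ℕ) {ys} → Unique (xs ++ ys) → Unique xs
unique-++ˡ xs {ys} = unique-⊆ (Sublist.++⁺ʳ ys ⊆-refl)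

unique-++ʳ : ∀ (xs : List ℕ) {ys} → Unique (xs ++ ys) → Unique ys
unique-++ʳ xs = unique-⊆ (Sublist.++⁺ˡ xs ⊆-refl)

unique-disjoint : ∀ (xs : List ℕ) {ys z} → Unique (xs ++ ys) → z ∈ xs → z ∈ ys → ⊥
unique-disjoint (x ∷ xs) (x∉ ∷ _) (here refl) z∈ys = lookup (All.++⁻ʳ xs x∉) z∈ys refl
unique-disjoint (x ∷ xs) (_ ∷ u) (there z∈xs) z∈ys = unique-disjoint xs u z∈xs z∈ys

∉-∷ : ∀ {t u : ℕ} {xs} → u ≢ t → t ∉ xs → t ∉ (u ∷ xs)
∉-∷ u≢t t∉ (here t≡u) = u≢t (sym t≡u)
∉-∷ u≢t t∉ (there t∈) = t∉ t∈

any-split : ∀ {A : Set} {P : A → Set} {xs} → Any P xs →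
            Σ (List A) λ pre → Σ A λ x → Σ (List A) λ post → xs ≡ pre ++ x ∷ post × P x
any-split p with find p
... | x , x∈xs , px with ∈-∃++ x∈xs
...   | pre , post , eq = pre , x , post , eq , px

≡ᵇ-true : ∀ {v t} → (v ≡ᵇ t) ≡ true → v ≡ t
≡ᵇ-true {v} {t} eq = ≡ᵇ⇒≡ v t (subst T (sym eq) tt)

≡ᵇ-false : ∀ {v t} → (v ≡ᵇ t) ≡ false → v ≢ t
≡ᵇ-false {v} {t} eq v≡t = subst T eq (≡⇒≡ᵇ v t v≡t)

∨-true : ∀ a {b} → a ∨ b ≡ true → a ≡ true ⊎ b ≡ true
∨-true true _ = inj₁ refl
∨-true false eq = inj₂ eq

∨-trueʳ : ∀ a {b} → b ≡ true → a ∨ b ≡ true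
∨-trueʳ true _ = refl
∨-trueʳ false eq = eq

∨-trueˡ : ∀ {a} b → a ≡ true → a ∨ b ≡ true
∨-trueˡ b refl = refl

rootId : Tree → ℕ
rootId (node v _) = v

children : Tree → List Edge
children (node _ cs) = cs

LeafAmong : ℕ → List Edge → Set
LeafAmong z cs = Any (λ p → LeafIn z (proj₂ p)) cs

Branching : List Edge → Set
Branching cs = length cs ≡ 0 ⊎ 2 ≤ length cs

ChildOK : Edge → Set
ChildOK p = InnerOK (proj₂ p)

innerOK⇒phylogenetic : ∀ S → InnerOK S → Unique (ids S) → Phylogenetic S
innerOK⇒phylogenetic (node w ws) (inner-ok br oks) u = u , br , oks

phylogenetic-unique : ∀ T → Phylogenetic T → Unique (ids T)
phylogenetic-unique (node u cs) (uq , _) = uq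

idsL-++ : ∀ xs ys → idsL (xs ++ ys) ≡ idsL xs ++ idsL ys
idsL-++ [] ys = refl
idsL-++ ((_ , c) ∷ xs) ys rewrite idsL-++ xs ys = sym (++-assoc (ids c) (idsL xs) (idsL ys))

unique-child : ∀ pre e post → Unique (idsL (pre ++ e ∷ post)) → Unique (ids (proj₂ e))
unique-child pre e post u rewrite idsL-++ pre (e ∷ post) =
  unique-++ˡ (ids (proj₂ e)) (unique-++ʳ (idsL pre) u)

mutual
  leaf∈ids : ∀ {z T} → LeafIn z T → z ∈ ids T
  leaf∈ids here = here refl
  leaf∈ids (there l) = there (leaf∈idsL l)

  leaf∈idsL : ∀ {z cs} → LeafAmong z cs → z ∈ idsL cs
  leaf∈idsL {cs = (_ , c) ∷ cs} (here l) = ∈-++⁺ˡ (leaf∈ids l)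
  leaf∈idsL {cs = (_ , c) ∷ cs} (there l) = ∈-++⁺ʳ (ids c) (leaf∈idsL l)

leaf≢ : ∀ {z t T} → t ∉ ids T → LeafIn z T → z ≢ t
leaf≢ {T = T} t∉T l z≡t = t∉T (subst (_∈ ids T) z≡t (leaf∈ids l))

someLeaf : ∀ T → Σ ℕ λ z → LeafIn z T
someLeaf (node v []) = v , here
someLeaf (node v ((_ , c) ∷ _)) with someLeaf c
... | z , l = z , there (here l)

-- OneSub S T: S is the subtree below some 1-edge of T.
mutual
  data OneSub (S : Tree) : Tree → Set where
    oneSub : ∀ {u cs} → OneSubL S cs → OneSub S (node u cs)

  OneSubL : Tree → List Edge → Set
  OneSubL S cs = Any (OneSubE S) cs

  OneSubE : Tree → Edge → Set
  OneSubE S e = (proj₁ e ≡ true × proj₂ e ≡ S) ⊎ OneSub S (proj₂ e)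

oneSubL⇒oneSubE : ∀ {S a u cs} → OneSubL S cs → OneSubE S (a , node u cs)
oneSubL⇒oneSubE s = inj₂ (oneSub s)

mutual
  oneSub-leaf : ∀ {S T z} → OneSub S T → LeafIn z S → LeafIn z T
  oneSub-leaf (oneSub s) l = there (oneSubL-leaf s l)

  oneSubL-leaf : ∀ {S cs z} → OneSubL S cs → LeafIn z S → LeafAmong z cs
  oneSubL-leaf (here s) l = here (oneSubE-leaf s l)
  oneSubL-leaf (there s) l = there (oneSubL-leaf s l)

  oneSubE-leaf : ∀ {S e z} → OneSubE S e → LeafIn z S → LeafIn z (proj₂ e)
  oneSubE-leaf (inj₁ (_ , refl)) l = l
  oneSubE-leaf (inj₂ s) l = oneSub-leaf s l

mutual
  oneSub-root∈ : ∀ {S T} → OneSub S T → rootId S ∈ idsL (children T)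
  oneSub-root∈ (oneSub s) = oneSubL-root∈ s

  oneSubL-root∈ : ∀ {S cs} → OneSubL S cs → rootId S ∈ idsL cs
  oneSubL-root∈ {cs = (_ , c) ∷ cs} (here s) = ∈-++⁺ˡ (oneSubE-root∈ s)
  oneSubL-root∈ {cs = (_ , c) ∷ cs} (there s) = ∈-++⁺ʳ (ids c) (oneSubL-root∈ s)

  oneSubE-root∈ : ∀ {S e} → OneSubE S e → rootId S ∈ ids (proj₂ e)
  oneSubE-root∈ {e = _ , node v cs} (inj₁ (_ , refl)) = here refl
  oneSubE-root∈ {e = _ , node v cs} (inj₂ s) = there (oneSub-root∈ s)

mutual
  oneSub-trans : ∀ {A B C} → OneSub A B → OneSub B C → OneSub A C
  oneSub-trans ab (oneSub s) = oneSub (oneSubL-trans ab s)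

  oneSubL-trans : ∀ {A B cs} → OneSub A B → OneSubL B cs → OneSubL A cs
  oneSubL-trans ab (here s) = here (oneSubE-trans ab s)
  oneSubL-trans ab (there s) = there (oneSubL-trans ab s)

  oneSubE-trans : ∀ {A B e} → OneSub A B → OneSubE B e → OneSubE A e
  oneSubE-trans ab (inj₁ (_ , refl)) = inj₂ ab
  oneSubE-trans ab (inj₂ s) = inj₂ (oneSub-trans ab s)

mutual
  oneSub-unique : ∀ {S T} → OneSub S T → Unique (ids T) → Unique (ids S)
  oneSub-unique (oneSub s) (_ ∷ u) = oneSubL-unique s u

  oneSubL-unique : ∀ {S cs} → OneSubL S cs → Unique (idsL cs) → Unique (ids S)
  oneSubL-unique {cs = (_ , c) ∷ cs} (here (inj₁ (_ , refl))) u = unique-++ˡ (ids c) u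
  oneSubL-unique {cs = (_ , c) ∷ cs} (here (inj₂ s)) u = oneSub-unique s (unique-++ˡ (ids c) u)
  oneSubL-unique {cs = (_ , c) ∷ cs} (there s) u = oneSubL-unique s (unique-++ʳ (ids c) u)

oneSub-root≢ : ∀ {S U} → OneSub S U → Unique (ids U) → rootId S ≢ rootId U
oneSub-root≢ {U = node w ws} s (w∉ ∷ _) eq = lookup w∉ (oneSub-root∈ s) (sym eq)

-- 3. The relation explained by a tree, via separating 1-edges

record Separation (T : Tree) (x y : ℕ) : Set where
  constructor separation
  field
    x∈T  : LeafIn x T
    sub  : Tree
    1sub : OneSub sub T
    y∈S  : LeafIn y sub
    x∉S  : ¬ LeafIn x sub

mutual
  oneSub⇒onePath : ∀ {S T y} → OneSub S T → LeafIn y S → OnePath y T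
  oneSub⇒onePath (oneSub s) l = step (oneSubL⇒onePath s l)

  oneSubL⇒onePath : ∀ {S cs y} → OneSubL S cs → LeafIn y S → Any (OneVia y) cs
  oneSubL⇒onePath (here s) l = here (oneSubE⇒oneVia s l)
  oneSubL⇒onePath (there s) l = there (oneSubL⇒onePath s l)

  oneSubE⇒oneVia : ∀ {S e y} → OneSubE S e → LeafIn y S → OneVia y e
  oneSubE⇒oneVia {e = b , c} (inj₁ (b≡1 , refl)) l = l , inj₁ b≡1
  oneSubE⇒oneVia {e = b , c} (inj₂ s) l = oneSub-leaf s l , inj₂ (oneSub⇒onePath s l)

OneSubOver : ℕ → (Tree → Set) → Tree → Set
OneSubOver y Below T = Σ Tree λ S → Below S × LeafIn y S × (∀ z → LeafIn z S → LeafIn z T)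

mutual
  oneVia⇒oneSubE : ∀ {y e} → OneVia y e → OneSubOver y (λ S → OneSubE S e) (proj₂ e)
  oneVia⇒oneSubE {e = b , c} (ly , inj₁ refl) = c , inj₁ (refl , refl) , ly , (λ z l → l)
  oneVia⇒oneSubE {e = b , c} (ly , inj₂ p) with onePath⇒oneSub p
  ... | S , s , lyS , sub = S , inj₂ s , lyS , sub

  onePath⇒oneSub : ∀ {y T} → OnePath y T → OneSubOver y (λ S → OneSub S T) T
  onePath⇒oneSub (step a) with onePathL⇒oneSubL a
  ... | S , s , ly , sub = S , oneSub s , ly , (λ z l → there (sub z l))

  onePathL⇒oneSubL : ∀ {y cs} → Any (OneVia y) cs →
                     Σ Tree λ S → OneSubL S cs × LeafIn y S × (∀ z → LeafIn z S → LeafAmong z cs)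
  onePathL⇒oneSubL (here v) with oneVia⇒oneSubE v
  ... | S , s , ly , sub = S , here s , ly , (λ z l → here (sub z l))
  onePathL⇒oneSubL (there a) with onePathL⇒oneSubL a
  ... | S , s , ly , sub = S , there s , ly , (λ z l → there (sub z l))

SplitIn : (Edge → Set) → (Edge → Set) → List Edge → Set
SplitIn P Q cs = Σ (List Edge) λ pre → Σ (List Edge) λ mid → Σ (List Edge) λ post → Σ Edge λ a → Σ Edge λ b →
  cs ≡ pre ++ (a ∷ mid ++ (b ∷ post)) × ((P a × Q b) ⊎ (Q a × P b))

splitIn-cons : ∀ {P Q} x {cs} → SplitIn P Q cs → SplitIn P Q (x ∷ cs)
splitIn-cons x (pre , mid , post , a , b , refl , pq) = x ∷ pre , mid , post , a , b , refl , pq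

-- a separation yields a pair of the relation: at lca(x,y) the leaves x and
-- y lie below different children, and the separating 1-edge lies on the
-- path to y
mutual
  separation⇒rel : ∀ {T x y} → Separation T x y → Rel T x y
  separation⇒rel (separation here _ (oneSub ()) _ _)
  separation⇒rel (separation (there lx) S (oneSub s) ly nx) with separationL lx s ly nx
  ... | inj₁ r = inside r
  ... | inj₂ (pre , mid , post , a , b , eq , inj₁ (la , sb)) = split pre mid post a b eq (inj₁ (la , oneSubE⇒oneVia sb ly))
  ... | inj₂ (pre , mid , post , a , b , eq , inj₂ (sa , lb)) = split pre mid post a b eq (inj₂ (lb , oneSubE⇒oneVia sa ly))

  separationL : ∀ {cs S x y} → LeafAmong x cs → OneSubL S cs → LeafIn y S → ¬ LeafIn x S →
                Any (λ p → Rel (proj₂ p) x y) cs ⊎ SplitIn (λ e → LeafIn x (proj₂ e)) (OneSubE S) cs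
  separationL (here lx) (here (inj₁ (_ , refl))) ly nx = ⊥-elim (nx lx)
  separationL (here lx) (here (inj₂ s)) ly nx = inj₁ (here (separation⇒rel (separation lx _ s ly nx)))
  separationL {c ∷ cs} (here lx) (there s) ly nx with any-split s
  ... | mid , b , post , refl , sb = inj₂ ([] , mid , post , c , b , refl , inj₁ (lx , sb))
  separationL {c ∷ cs} (there lx) (here s) ly nx with any-split lx
  ... | mid , b , post , refl , lb = inj₂ ([] , mid , post , c , b , refl , inj₂ (s , lb))
  separationL {c ∷ cs} (there lx) (there s) ly nx with separationL lx s ly nx
  ... | inj₁ r = inj₁ (there r)
  ... | inj₂ sp = inj₂ (splitIn-cons c sp)

module _ {P : Edge → Set} (pre : List Edge) (a : Edge) (mid : List Edge) (b : Edge) (post : List Edge) where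

  any-first : P a → Any P (pre ++ (a ∷ mid ++ (b ∷ post)))
  any-first p = Any.++⁺ʳ pre (here p)

  any-second : P b → Any P (pre ++ (a ∷ mid ++ (b ∷ post)))
  any-second p = Any.++⁺ʳ pre (there (Any.++⁺ʳ mid (here p)))

children-disjoint : ∀ pre a mid b post {z} → Unique (idsL (pre ++ (a ∷ mid ++ (b ∷ post)))) →
                    z ∈ ids (proj₂ a) → z ∈ ids (proj₂ b) → ⊥
children-disjoint pre a mid b post u za zb rewrite idsL-++ pre (a ∷ mid ++ (b ∷ post)) =
  unique-disjoint (ids (proj₂ a)) (unique-++ʳ (idsL pre) u)
    za (subst (_ ∈_) (sym (idsL-++ mid (b ∷ post))) (∈-++⁺ʳ (idsL mid) (∈-++⁺ˡ zb)))

mutual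
  rel⇒separation : ∀ {T x y} → Unique (ids T) → Rel T x y → Separation T x y
  rel⇒separation {node u cs} (_ ∷ uq) (inside a) with rel⇒separationL uq a
  ... | lx , S , s , ly , nx = separation (there lx) S (oneSub s) ly nx
  rel⇒separation {node u cs} (_ ∷ uq) (split pre mid post a b refl (inj₁ (lxa , vb))) with oneVia⇒oneSubE vb
  ... | S , s , ly , sub = separation (there (any-first pre a mid b post lxa)) S (oneSub (any-second pre a mid b post s)) ly
        (λ lxS → children-disjoint pre a mid b post uq (leaf∈ids lxa) (leaf∈ids (sub _ lxS)))
  rel⇒separation {node u cs} (_ ∷ uq) (split pre mid post a b refl (inj₂ (lxb , va))) with oneVia⇒oneSubE va
  ... | S , s , ly , sub = separation (there (any-second pre a mid b post lxb)) S (oneSub (any-first pre a mid b post s)) ly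
        (λ lxS → children-disjoint pre a mid b post uq (leaf∈ids (sub _ lxS)) (leaf∈ids lxb))

  rel⇒separationL : ∀ {cs x y} → Unique (idsL cs) → Any (λ p → Rel (proj₂ p) x y) cs →
                    LeafAmong x cs × Σ Tree λ S → OneSubL S cs × LeafIn y S × ¬ LeafIn x S
  rel⇒separationL {(_ , c) ∷ cs} u (here r) with rel⇒separation (unique-++ˡ (ids c) u) r
  ... | separation lx S s ly nx = here lx , S , here (inj₂ s) , ly , nx
  rel⇒separationL {(_ , c) ∷ cs} u (there a) with rel⇒separationL (unique-++ʳ (ids c) u) a
  ... | lx , S , s , ly , nx = there lx , S , there s , ly , nx

mutual
  rel-leaves : ∀ {T x y} → Rel T x y → LeafIn x T × LeafIn y T
  rel-leaves (inside a) with rel-leavesL a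
  ... | lx , ly = there lx , there ly
  rel-leaves (split pre mid post a b refl (inj₁ (lxa , (lyb , _)))) =
    there (any-first pre a mid b post lxa) , there (any-second pre a mid b post lyb)
  rel-leaves (split pre mid post a b refl (inj₂ (lxb , (lya , _)))) =
    there (any-second pre a mid b post lxb) , there (any-first pre a mid b post lya)

  rel-leavesL : ∀ {cs x y} → Any (λ p → Rel (proj₂ p) x y) cs → LeafAmong x cs × LeafAmong y cs
  rel-leavesL (here r) with rel-leaves r
  ... | lx , ly = here lx , here ly
  rel-leavesL (there a) with rel-leavesL a
  ... | lx , ly = there lx , there ly

-- 4. The extended contraction of the edge with child t

stepChildren : Step → List Edge
stepChildren (removedLeaf r) = r
stepChildren (other r) = r

stepChildren-cons : ∀ e s → stepChildren (cons e s) ≡ e ∷ stepChildren s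
stepChildren-cons e (removedLeaf r) = refl
stepChildren-cons e (other r) = refl

StepLength : List Edge → Step → Set
StepLength cs (removedLeaf r) = suc (length r) ≡ length cs
StepLength cs (other r) = length cs ≤ length r

StepRemoves : ℕ → List Edge → Step → Set
StepRemoves t cs (removedLeaf r) = LeafAmong t cs
StepRemoves t cs (other r) = ⊤

branching-≢1 : ∀ {d} ds → Branching (d ∷ ds) → suc 0 ≡ suc (length ds) → ⊥
branching-≢1 [] (inj₁ ()) _
branching-≢1 [] (inj₂ (s≤s ())) _
branching-≢1 (_ ∷ _) _ ()

nonempty-≰0 : ∀ {d : Edge} {ds} → length (d ∷ ds) ≤ 0 → ⊥
nonempty-≰0 ()

branching-≥2 : ∀ {d : Edge} {ds} → Branching (d ∷ ds) → 2 ≤ length (d ∷ ds)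
branching-≥2 (inj₁ ())
branching-≥2 (inj₂ p) = p

module _ (t : ℕ) where

  stepL-length : ∀ cs → StepLength cs (stepL t cs)
  stepL-length [] = z≤n
  stepL-length ((b , node v []) ∷ rest) with v ≡ᵇ t
  ... | true = refl
  ... | false = extend (stepL t rest) (stepL-length rest)
    where
    extend : ∀ s → StepLength rest s → StepLength ((b , node v []) ∷ rest) (cons (b , node v []) s)
    extend (removedLeaf r) p = cong suc p
    extend (other r) p = s≤s p
  stepL-length ((b , node v (d ∷ ds)) ∷ rest) with v ≡ᵇ t
  ... | true = s≤s (subst (length rest ≤_) (sym (length-++ ds)) (m≤n+m _ _))
  ... | false = extend (stepL t rest) (stepL-length rest)
    where
    extend : ∀ s → StepLength rest s → StepLength ((b , node v (d ∷ ds)) ∷ rest) (cons (edgeC t b v (d ∷ ds)) s)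
    extend (removedLeaf r) p = cong suc p
    extend (other r) p = s≤s p

  stepL-removes : ∀ cs → StepRemoves t cs (stepL t cs)
  stepL-removes [] = tt
  stepL-removes ((b , node v []) ∷ rest) with v ≡ᵇ t in eq
  ... | true = here (subst (λ w → LeafIn t (node w [])) (sym (≡ᵇ-true eq)) here)
  ... | false = extend (stepL t rest) (stepL-removes rest)
    where
    extend : ∀ s → StepRemoves t rest s → StepRemoves t ((b , node v []) ∷ rest) (cons (b , node v []) s)
    extend (removedLeaf r) p = there p
    extend (other r) p = tt
  stepL-removes ((b , node v (d ∷ ds)) ∷ rest) with v ≡ᵇ t
  ... | true = tt
  ... | false = extend (stepL t rest) (stepL-removes rest)
    where
    extend : ∀ s → StepRemoves t rest s → StepRemoves t ((b , node v (d ∷ ds)) ∷ rest) (cons (edgeC t b v (d ∷ ds)) s)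
    extend (removedLeaf r) p = there p
    extend (other r) p = tt

  mutual
    leaf-stepL⁻ : ∀ cs z → All ChildOK cs → LeafAmong z (stepChildren (stepL t cs)) → LeafAmong z cs
    leaf-stepL⁻ [] z ok ()
    leaf-stepL⁻ ((b , node v []) ∷ rest) z (ok ∷ oks) l with v ≡ᵇ t
    ... | true = there l
    ... | false rewrite stepChildren-cons (b , node v []) (stepL t rest) with l
    ...   | here l' = here l'
    ...   | there l' = there (leaf-stepL⁻ rest z oks l')
    leaf-stepL⁻ ((b , node v (d ∷ ds)) ∷ rest) z (inner-ok br okc ∷ oks) l with v ≡ᵇ t
    ... | true with Any.++⁻ (d ∷ ds) l
    ...   | inj₁ l' = here (there l')
    ...   | inj₂ l' = there l'
    leaf-stepL⁻ ((b , node v (d ∷ ds)) ∷ rest) z (inner-ok br okc ∷ oks) l | false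
      rewrite stepChildren-cons (edgeC t b v (d ∷ ds)) (stepL t rest) with l
    ... | here l' = here (leaf-edgeC⁻ b v (d ∷ ds) z br okc l')
    ... | there l' = there (leaf-stepL⁻ rest z oks l')

    leaf-edgeC⁻ : ∀ a u cs z → Branching cs → All ChildOK cs →
                  LeafIn z (proj₂ (edgeC t a u cs)) → LeafIn z (node u cs)
    leaf-edgeC⁻ a u [] z br ok l = l
    leaf-edgeC⁻ a u (d ∷ ds) z br ok l
      with stepL t (d ∷ ds) | leaf-stepL⁻ (d ∷ ds) z ok | stepL-length (d ∷ ds)
    ... | removedLeaf ((b , c) ∷ []) | back | _ = there (back (here l))
    ... | removedLeaf [] | _ | len = ⊥-elim (branching-≢1 {d} ds br len)
    ... | removedLeaf (_ ∷ _ ∷ _) | back | _ with l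
    ...   | there l' = there (back l')
    leaf-edgeC⁻ a u (d ∷ ds) z br ok l | other [] | _ | len = ⊥-elim (nonempty-≰0 {d} {ds} len)
    leaf-edgeC⁻ a u (d ∷ ds) z br ok (there l') | other (_ ∷ _) | back | _ = there (back l')

  mutual
    leaf-stepL⁺ : ∀ cs z → LeafAmong z cs → z ≢ t → LeafAmong z (stepChildren (stepL t cs))
    leaf-stepL⁺ [] z () z≢t
    leaf-stepL⁺ ((b , node v []) ∷ rest) z l z≢t with v ≡ᵇ t in eq
    leaf-stepL⁺ ((b , node v []) ∷ rest) z (here here) z≢t | true = ⊥-elim (z≢t (≡ᵇ-true eq))
    leaf-stepL⁺ ((b , node v []) ∷ rest) z (there l) z≢t | true = l
    ... | false rewrite stepChildren-cons (b , node v []) (stepL t rest) with l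
    ...   | here l' = here l'
    ...   | there l' = there (leaf-stepL⁺ rest z l' z≢t)
    leaf-stepL⁺ ((b , node v (d ∷ ds)) ∷ rest) z l z≢t with v ≡ᵇ t
    leaf-stepL⁺ ((b , node v (d ∷ ds)) ∷ rest) z (here (there l)) z≢t | true = Any.++⁺ˡ l
    leaf-stepL⁺ ((b , node v (d ∷ ds)) ∷ rest) z (there l) z≢t | true = Any.++⁺ʳ (d ∷ ds) l
    ... | false rewrite stepChildren-cons (edgeC t b v (d ∷ ds)) (stepL t rest) with l
    ...   | here l' = here (leaf-edgeC⁺ b v (d ∷ ds) z l' z≢t)
    ...   | there l' = there (leaf-stepL⁺ rest z l' z≢t)

    leaf-edgeC⁺ : ∀ a u cs z → LeafIn z (node u cs) → z ≢ t → LeafIn z (proj₂ (edgeC t a u cs))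
    leaf-edgeC⁺ a u [] z l z≢t = l
    leaf-edgeC⁺ a u (d ∷ ds) z (there l) z≢t with stepL t (d ∷ ds) | leaf-stepL⁺ (d ∷ ds) z l z≢t
    ... | removedLeaf ((b , c) ∷ []) | here l' = l'
    ... | removedLeaf [] | ()
    ... | removedLeaf (_ ∷ _ ∷ _) | l' = there l'
    ... | other r | l' = there l'

  mutual
    ids-stepL-⊆ : ∀ cs → All ChildOK cs → idsL (stepChildren (stepL t cs)) ⊆ idsL cs
    ids-stepL-⊆ [] _ = []
    ids-stepL-⊆ ((b , node v []) ∷ rest) (_ ∷ oks) with v ≡ᵇ t
    ... | true = v ∷ʳ ⊆-refl
    ... | false rewrite stepChildren-cons (b , node v []) (stepL t rest) = refl ∷ ids-stepL-⊆ rest oks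
    ids-stepL-⊆ ((b , node v (d ∷ ds)) ∷ rest) (inner-ok br okc ∷ oks) with v ≡ᵇ t
    ... | true rewrite idsL-++ (d ∷ ds) rest = v ∷ʳ ⊆-refl
    ... | false rewrite stepChildren-cons (edgeC t b v (d ∷ ds)) (stepL t rest) =
      Sublist.++⁺ (ids-edgeC-⊆ b v (d ∷ ds) okc) (ids-stepL-⊆ rest oks)

    ids-edgeC-⊆ : ∀ a u cs → All ChildOK cs → ids (proj₂ (edgeC t a u cs)) ⊆ ids (node u cs)
    ids-edgeC-⊆ a u [] _ = ⊆-refl
    ids-edgeC-⊆ a u (d ∷ ds) oks with stepL t (d ∷ ds) | ids-stepL-⊆ (d ∷ ds) oks
    ... | removedLeaf ((b , c) ∷ []) | sub = u ∷ʳ subst (_⊆ _) (++-identityʳ (ids c)) sub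
    ... | removedLeaf [] | sub = refl ∷ sub
    ... | removedLeaf (_ ∷ _ ∷ _) | sub = refl ∷ sub
    ... | other r | sub = refl ∷ sub

  mutual
    t∉stepL : ∀ cs → All ChildOK cs → Unique (idsL cs) → t ∉ idsL (stepChildren (stepL t cs))
    t∉stepL [] _ u ()
    t∉stepL ((b , node v []) ∷ rest) (_ ∷ oks) (v∉ ∷ uq) with v ≡ᵇ t in eq
    ... | true = λ t∈ → lookup v∉ t∈ (≡ᵇ-true eq)
    ... | false rewrite stepChildren-cons (b , node v []) (stepL t rest) =
      ∉-∷ (≡ᵇ-false eq) (t∉stepL rest oks uq)
    t∉stepL ((b , node v (d ∷ ds)) ∷ rest) (inner-ok br okc ∷ oks) (v∉ ∷ uq) with v ≡ᵇ t in eq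
    ... | true rewrite idsL-++ (d ∷ ds) rest = λ t∈ → lookup v∉ t∈ (≡ᵇ-true eq)
    ... | false rewrite stepChildren-cons (edgeC t b v (d ∷ ds)) (stepL t rest) = t∉
      where
      t∉ : t ∉ (ids (proj₂ (edgeC t b v (d ∷ ds))) ++ idsL (stepChildren (stepL t rest)))
      t∉ t∈ with ∈-++⁻ (ids (proj₂ (edgeC t b v (d ∷ ds)))) t∈
      ... | inj₁ t∈′ = t∉edgeC b v (d ∷ ds) okc (unique-++ˡ (v ∷ idsL (d ∷ ds)) (v∉ ∷ uq)) (≡ᵇ-false eq) t∈′
      ... | inj₂ t∈′ = t∉stepL rest oks (unique-++ʳ (v ∷ idsL (d ∷ ds)) (v∉ ∷ uq)) t∈′

    t∉edgeC : ∀ a u cs → All ChildOK cs → Unique (u ∷ idsL cs) → u ≢ t → t ∉ ids (proj₂ (edgeC t a u cs))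
    t∉edgeC a u [] _ _ u≢t = ∉-∷ u≢t (λ ())
    t∉edgeC a u (d ∷ ds) oks (_ ∷ uq) u≢t with stepL t (d ∷ ds) | t∉stepL (d ∷ ds) oks uq
    ... | removedLeaf ((b , c) ∷ []) | t∉ = λ t∈ → t∉ (∈-++⁺ˡ t∈)
    ... | removedLeaf [] | t∉ = ∉-∷ u≢t t∉
    ... | removedLeaf (_ ∷ _ ∷ _) | t∉ = ∉-∷ u≢t t∉
    ... | other r | t∉ = ∉-∷ u≢t t∉

  -- contraction preserves the degree conditions (this is what the
  -- suppression of degree-2 vertices is for)
  mutual
    ok-stepL : ∀ cs → All ChildOK cs → All ChildOK (stepChildren (stepL t cs))
    ok-stepL [] _ = []
    ok-stepL ((b , node v []) ∷ rest) (ok ∷ oks) with v ≡ᵇ t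
    ... | true = oks
    ... | false rewrite stepChildren-cons (b , node v []) (stepL t rest) = ok ∷ ok-stepL rest oks
    ok-stepL ((b , node v (d ∷ ds)) ∷ rest) (inner-ok br okc ∷ oks) with v ≡ᵇ t
    ... | true = All.++⁺ okc oks
    ... | false rewrite stepChildren-cons (edgeC t b v (d ∷ ds)) (stepL t rest) =
      ok-edgeC b v (d ∷ ds) br okc ∷ ok-stepL rest oks

    ok-edgeC : ∀ a u cs → Branching cs → All ChildOK cs → InnerOK (proj₂ (edgeC t a u cs))
    ok-edgeC a u [] br oks = inner-ok br oks
    ok-edgeC a u (d ∷ ds) br oks with stepL t (d ∷ ds) | ok-stepL (d ∷ ds) oks | stepL-length (d ∷ ds)
    ... | removedLeaf ((b , c) ∷ []) | ok ∷ [] | _ = ok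
    ... | removedLeaf [] | _ | _ = inner-ok (inj₁ refl) []
    ... | removedLeaf (_ ∷ _ ∷ _) | oks′ | _ = inner-ok (inj₂ (s≤s (s≤s z≤n))) oks′
    ... | other r | oks′ | len = inner-ok (inj₂ (≤-trans (branching-≥2 {d} {ds} br) len)) oks′

  LeafCorr : Tree → Tree → Set
  LeafCorr S S′ = (∀ z → LeafIn z S′ → LeafIn z S) × (∀ z → LeafIn z S → z ≢ t → LeafIn z S′)

  leafCorr-refl : ∀ {S} → LeafCorr S S
  leafCorr-refl = (λ z l → l) , (λ z l _ → l)

  Origin : Tree → (Tree → Set) → Set
  Origin S′ P = Σ Tree λ S → P S × rootId S ≢ t × LeafCorr S S′

  mapOrigin : ∀ {S′} {P Q : Tree → Set} → (∀ {S} → P S → Q S) → Origin S′ P → Origin S′ Q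
  mapOrigin f (S , p , r , c) = S , f p , r , c

  origin-kept : ∀ a u d ds p r S′ → u ≢ t →
                (∀ z → LeafAmong z (p ∷ r) → LeafAmong z (d ∷ ds)) →
                (∀ z → LeafAmong z (d ∷ ds) → z ≢ t → LeafAmong z (p ∷ r)) →
                (OneSubL S′ (p ∷ r) → Origin S′ (λ S → OneSubL S (d ∷ ds))) →
                OneSubE S′ (a , node u (p ∷ r)) → Origin S′ (λ S → OneSubE S (a , node u (d ∷ ds)))
  origin-kept a u d ds p r S′ u≢t back forth rec (inj₁ (a≡1 , refl)) =
    node u (d ∷ ds) , inj₁ (a≡1 , refl) , u≢t , back′ , forth′
    where
    back′ : ∀ z → LeafIn z (node u (p ∷ r)) → LeafIn z (node u (d ∷ ds))
    back′ z (there l) = there (back z l)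
    forth′ : ∀ z → LeafIn z (node u (d ∷ ds)) → z ≢ t → LeafIn z (node u (p ∷ r))
    forth′ z (there l) z≢t = there (forth z l z≢t)
  origin-kept a u d ds p r S′ u≢t back forth rec (inj₂ (oneSub s)) = mapOrigin oneSubL⇒oneSubE (rec s)

  mutual
    origin-stepL : ∀ cs S′ → All ChildOK cs → Unique (idsL cs) → OneSubL S′ (stepChildren (stepL t cs)) →
                   Origin S′ (λ S → OneSubL S cs)
    origin-stepL [] S′ _ _ ()
    origin-stepL ((b , node v []) ∷ rest) S′ (_ ∷ oks) (v∉ ∷ uq) s with v ≡ᵇ t in eq
    ... | true = S′ , there s , (λ r≡t → lookup v∉ (oneSubL-root∈ s) (trans (≡ᵇ-true eq) (sym r≡t))) , leafCorr-refl
    ... | false rewrite stepChildren-cons (b , node v []) (stepL t rest) with s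
    ...   | here s′ with oneSubE-root∈ s′
    ...     | here r≡v = S′ , here s′ , (λ r≡t → ≡ᵇ-false eq (trans (sym r≡v) r≡t)) , leafCorr-refl
    origin-stepL ((b , node v []) ∷ rest) S′ (_ ∷ oks) (v∉ ∷ uq) s | false | there s′ =
      mapOrigin there (origin-stepL rest S′ oks uq s′)
    origin-stepL ((b , node v (d ∷ ds)) ∷ rest) S′ (inner-ok br okc ∷ oks) (v∉ ∷ uq) s with v ≡ᵇ t in eq
    ... | true with Any.++⁻ (d ∷ ds) s
    ...   | inj₁ s′ = S′ , here (oneSubL⇒oneSubE s′) ,
                      (λ r≡t → lookup v∉ (∈-++⁺ˡ (oneSubL-root∈ s′)) (trans (≡ᵇ-true eq) (sym r≡t))) , leafCorr-refl
    ...   | inj₂ s′ = S′ , there s′ ,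
                      (λ r≡t → lookup v∉ (∈-++⁺ʳ (idsL (d ∷ ds)) (oneSubL-root∈ s′)) (trans (≡ᵇ-true eq) (sym r≡t))) , leafCorr-refl
    origin-stepL ((b , node v (d ∷ ds)) ∷ rest) S′ (inner-ok br okc ∷ oks) (v∉ ∷ uq) s | false
      rewrite stepChildren-cons (edgeC t b v (d ∷ ds)) (stepL t rest) with s
    ... | here s′ = mapOrigin here (origin-edgeC b v (d ∷ ds) S′ br okc (unique-++ˡ (v ∷ idsL (d ∷ ds)) (v∉ ∷ uq)) (≡ᵇ-false eq) s′)
    ... | there s′ = mapOrigin there (origin-stepL rest S′ oks (unique-++ʳ (v ∷ idsL (d ∷ ds)) (v∉ ∷ uq)) s′)

    origin-edgeC : ∀ a u cs S′ → Branching cs → All ChildOK cs → Unique (u ∷ idsL cs) → u ≢ t →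
                   OneSubE S′ (edgeC t a u cs) → Origin S′ (λ S → OneSubE S (a , node u cs))
    origin-edgeC a u [] S′ br oks uq u≢t s with oneSubE-root∈ s
    ... | here r≡u = S′ , s , (λ r≡t → u≢t (trans (sym r≡u) r≡t)) , leafCorr-refl
    origin-edgeC a u (d ∷ ds) S′ br oks (_ ∷ uq) u≢t s
      with stepL t (d ∷ ds) | (λ S → origin-stepL (d ∷ ds) S oks uq) | (λ z → leaf-stepL⁻ (d ∷ ds) z oks)
         | leaf-stepL⁺ (d ∷ ds) | stepL-length (d ∷ ds)
    ... | removedLeaf ((b , c) ∷ []) | rec | back | forth | _ = suppressed s
      where
      -- u was suppressed: the merged edge is a 1-edge iff one of its parts was
      suppressed : OneSubE S′ (a ∨ b , c) → Origin S′ (λ S → OneSubE S (a , node u (d ∷ ds)))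
      suppressed (inj₁ (ab≡1 , refl)) with ∨-true a ab≡1
      ... | inj₁ a≡1 = node u (d ∷ ds) , inj₁ (a≡1 , refl) , u≢t , (λ z l → there (back z (here l))) , forth′
        where
        forth′ : ∀ z → LeafIn z (node u (d ∷ ds)) → z ≢ t → LeafIn z c
        forth′ z (there l) z≢t with forth z l z≢t
        ... | here l′ = l′
      ... | inj₂ b≡1 = mapOrigin oneSubL⇒oneSubE (rec c (here (inj₁ (b≡1 , refl))))
      suppressed (inj₂ s′) = mapOrigin oneSubL⇒oneSubE (rec S′ (here (inj₂ s′)))
    ... | removedLeaf [] | _ | _ | _ | len = ⊥-elim (branching-≢1 {d} ds br len)
    ... | removedLeaf (p ∷ q ∷ r) | rec | back | forth | _ = origin-kept a u d ds p (q ∷ r) S′ u≢t back forth (rec S′) s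
    ... | other [] | _ | _ | _ | len = ⊥-elim (nonempty-≰0 {d} {ds} len)
    ... | other (p ∷ r) | rec | back | forth | _ = origin-kept a u d ds p r S′ u≢t back forth (rec S′) s

  -- a 1-subtree S whose root is not t has an image S′ with P S′ in the
  -- contracted tree; its root is that of S, unless t was a leaf of the
  -- part L of the tree under consideration (then suppression may have
  -- replaced the root of S by its remaining child)
  Image : Tree → (Tree → Set) → Set → Set
  Image S P L = Σ Tree λ S′ → P S′ × LeafCorr S S′ × (rootId S′ ≡ rootId S ⊎ L)

  mapImage : ∀ {S} {P Q : Tree → Set} {L M : Set} → (∀ {S′} → P S′ → Q S′) → (L → M) → Image S P L → Image S Q M
  mapImage f g (S′ , p , c , inj₁ r) = S′ , f p , c , inj₁ r
  mapImage f g (S′ , p , c , inj₂ l) = S′ , f p , c , inj₂ (g l)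

  image-kept : ∀ a u d ds p r S → u ≢ t →
               (∀ z → LeafAmong z (p ∷ r) → LeafAmong z (d ∷ ds)) →
               (∀ z → LeafAmong z (d ∷ ds) → z ≢ t → LeafAmong z (p ∷ r)) →
               (OneSubL S (d ∷ ds) → rootId S ≢ t → Image S (λ S′ → OneSubL S′ (p ∷ r)) (LeafAmong t (d ∷ ds))) →
               OneSubE S (a , node u (d ∷ ds)) → rootId S ≢ t →
               Image S (λ S′ → OneSubE S′ (a , node u (p ∷ r))) (LeafIn t (node u (d ∷ ds)))
  image-kept a u d ds p r S u≢t back forth rec (inj₁ (a≡1 , refl)) r≢t =
    node u (p ∷ r) , inj₁ (a≡1 , refl) , (back′ , forth′) , inj₁ refl
    where
    back′ : ∀ z → LeafIn z (node u (p ∷ r)) → LeafIn z (node u (d ∷ ds))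
    back′ z (there l) = there (back z l)
    forth′ : ∀ z → LeafIn z (node u (d ∷ ds)) → z ≢ t → LeafIn z (node u (p ∷ r))
    forth′ z (there l) z≢t = there (forth z l z≢t)
  image-kept a u d ds p r S u≢t back forth rec (inj₂ (oneSub s)) r≢t = mapImage oneSubL⇒oneSubE there (rec s r≢t)

  mutual
    image-stepL : ∀ cs S → All ChildOK cs → Unique (idsL cs) → OneSubL S cs → rootId S ≢ t →
                  Image S (λ S′ → OneSubL S′ (stepChildren (stepL t cs))) (LeafAmong t cs)
    image-stepL ((b , node v []) ∷ rest) S (_ ∷ oks) (v∉ ∷ uq) s r≢t with v ≡ᵇ t in eq
    image-stepL ((b , node v []) ∷ rest) S (_ ∷ oks) (v∉ ∷ uq) (here (inj₁ (_ , refl))) r≢t | true = ⊥-elim (r≢t (≡ᵇ-true eq))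
    image-stepL ((b , node v []) ∷ rest) S (_ ∷ oks) (v∉ ∷ uq) (here (inj₂ (oneSub ()))) r≢t | true
    image-stepL ((b , node v []) ∷ rest) S (_ ∷ oks) (v∉ ∷ uq) (there s) r≢t | true = S , s , leafCorr-refl , inj₁ refl
    image-stepL ((b , node v []) ∷ rest) S (_ ∷ oks) (v∉ ∷ uq) s r≢t | false
      rewrite stepChildren-cons (b , node v []) (stepL t rest) with s
    ... | here s′ = S , here s′ , leafCorr-refl , inj₁ refl
    ... | there s′ = mapImage there there (image-stepL rest S oks uq s′ r≢t)
    image-stepL ((b , node v (d ∷ ds)) ∷ rest) S (inner-ok br okc ∷ oks) (v∉ ∷ uq) s r≢t with v ≡ᵇ t in eq
    image-stepL ((b , node v (d ∷ ds)) ∷ rest) S (inner-ok br okc ∷ oks) (v∉ ∷ uq) (here (inj₁ (_ , refl))) r≢t | true =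
      ⊥-elim (r≢t (≡ᵇ-true eq))
    image-stepL ((b , node v (d ∷ ds)) ∷ rest) S (inner-ok br okc ∷ oks) (v∉ ∷ uq) (here (inj₂ (oneSub s))) r≢t | true =
      S , Any.++⁺ˡ s , leafCorr-refl , inj₁ refl
    image-stepL ((b , node v (d ∷ ds)) ∷ rest) S (inner-ok br okc ∷ oks) (v∉ ∷ uq) (there s) r≢t | true =
      S , Any.++⁺ʳ (d ∷ ds) s , leafCorr-refl , inj₁ refl
    image-stepL ((b , node v (d ∷ ds)) ∷ rest) S (inner-ok br okc ∷ oks) (v∉ ∷ uq) s r≢t | false
      rewrite stepChildren-cons (edgeC t b v (d ∷ ds)) (stepL t rest) with s
    ... | here s′ = mapImage here here
                      (image-edgeC b v (d ∷ ds) S br okc (unique-++ˡ (v ∷ idsL (d ∷ ds)) (v∉ ∷ uq)) (≡ᵇ-false eq) s′ r≢t)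
    ... | there s′ = mapImage there there (image-stepL rest S oks (unique-++ʳ (v ∷ idsL (d ∷ ds)) (v∉ ∷ uq)) s′ r≢t)

    image-edgeC : ∀ a u cs S → Branching cs → All ChildOK cs → Unique (u ∷ idsL cs) → u ≢ t →
                  OneSubE S (a , node u cs) → rootId S ≢ t →
                  Image S (λ S′ → OneSubE S′ (edgeC t a u cs)) (LeafIn t (node u cs))
    image-edgeC a u [] S br oks uq u≢t s r≢t = S , s , leafCorr-refl , inj₁ refl
    image-edgeC a u (d ∷ ds) S br oks (_ ∷ uq) u≢t s r≢t
      with stepL t (d ∷ ds) | (λ S → image-stepL (d ∷ ds) S oks uq) | (λ z → leaf-stepL⁻ (d ∷ ds) z oks)
         | leaf-stepL⁺ (d ∷ ds) | stepL-length (d ∷ ds) | stepL-removes (d ∷ ds)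
    ... | removedLeaf ((b , c) ∷ []) | rec | back | forth | _ | t-leaf = suppressed s
      where
      -- u is suppressed: a 1-edge into u or into c becomes the merged 1-edge
      suppressed : OneSubE S (a , node u (d ∷ ds)) → Image S (λ S′ → OneSubE S′ (a ∨ b , c)) (LeafIn t (node u (d ∷ ds)))
      suppressed (inj₁ (a≡1 , refl)) =
        c , inj₁ (∨-trueˡ b a≡1 , refl) , ((λ z l → there (back z (here l))) , forth′) , inj₂ (there t-leaf)
        where
        forth′ : ∀ z → LeafIn z (node u (d ∷ ds)) → z ≢ t → LeafIn z c
        forth′ z (there l) z≢t with forth z l z≢t
        ... | here l′ = l′
      suppressed (inj₂ (oneSub s′)) with rec S s′ r≢t
      ... | S′ , here (inj₁ (b≡1 , c≡S′)) , corr , r = S′ , inj₁ (∨-trueʳ a b≡1 , c≡S′) , corr , map₂ there r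
      ... | S′ , here (inj₂ s″) , corr , r = S′ , inj₂ s″ , corr , map₂ there r
    ... | removedLeaf [] | _ | _ | _ | len | _ = ⊥-elim (branching-≢1 {d} ds br len)
    ... | removedLeaf (p ∷ q ∷ r) | rec | back | forth | _ | _ = image-kept a u d ds p (q ∷ r) S u≢t back forth (rec S) s r≢t
    ... | other [] | _ | _ | _ | len | _ = ⊥-elim (nonempty-≰0 {d} {ds} len)
    ... | other (p ∷ r) | rec | back | forth | _ | _ = image-kept a u d ds p r S u≢t back forth (rec S) s r≢t

-- At the root the contraction behaves exactly like the contraction below a
-- 0-edge, except that a suppressed root is deleted, which only discards
-- the (0-)edge into it.  This lets all root facts follow from the
-- corresponding facts for edgeC.
contract-as-edge : ∀ t u cs → contract t (node u cs) ≡ proj₂ (edgeC t false u cs)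
contract-as-edge t u cs with stepL t cs
... | removedLeaf [] = refl
... | removedLeaf (_ ∷ []) = refl
... | removedLeaf (_ ∷ _ ∷ _) = refl
... | other r = refl

module _ (t : ℕ) where

  private
    root≢t : ∀ {u cs} → Phylogenetic (node u cs) → IsEdge t (node u cs) → u ≢ t
    root≢t ((u∉ ∷ _) , _) t∈ = lookup u∉ t∈

  contract-leaf⁻ : ∀ T z → Phylogenetic T → LeafIn z (contract t T) → LeafIn z T
  contract-leaf⁻ (node u cs) z (_ , br , oks) l =
    leaf-edgeC⁻ t false u cs z br oks (subst (LeafIn z) (contract-as-edge t u cs) l)

  contract-leaf⁺ : ∀ T z → LeafIn z T → z ≢ t → LeafIn z (contract t T)
  contract-leaf⁺ (node u cs) z l z≢t =
    subst (LeafIn z) (sym (contract-as-edge t u cs)) (leaf-edgeC⁺ t false u cs z l z≢t)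

  contract-removes : ∀ T → Phylogenetic T → IsEdge t T → t ∉ ids (contract t T)
  contract-removes (node u cs) ph@(uq , _ , oks) t∈ =
    subst (λ T → t ∉ ids T) (sym (contract-as-edge t u cs)) (t∉edgeC t false u cs oks uq (root≢t ph t∈))

  contract-phylogenetic : ∀ T → Phylogenetic T → Phylogenetic (contract t T)
  contract-phylogenetic (node u cs) (uq , br , oks) =
    subst Phylogenetic (sym (contract-as-edge t u cs))
      (innerOK⇒phylogenetic _ (ok-edgeC t false u cs br oks) (unique-⊆ (ids-edgeC-⊆ t false u cs oks) uq))

  contract-origin : ∀ T S′ → Phylogenetic T → IsEdge t T → OneSub S′ (contract t T) → Origin t S′ (λ S → OneSub S T)
  contract-origin (node u cs) S′ ph@(uq , br , oks) t∈ s′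
    with origin-edgeC t false u cs S′ br oks uq (root≢t ph t∈) (inj₂ (subst (OneSub S′) (contract-as-edge t u cs) s′))
  ... | S , inj₂ s , r≢t , corr = S , s , r≢t , corr

  -- every 1-subtree of T not rooted at t and missing some leaf x ≠ t
  -- survives in T_t (the leaf x rules out that it becomes all of T_t)
  contract-image : ∀ T S x → Phylogenetic T → IsEdge t T → OneSub S T → rootId S ≢ t →
                   LeafIn x T → x ≢ t → ¬ LeafIn x S → Image t S (λ S′ → OneSub S′ (contract t T)) (LeafIn t T)
  contract-image (node u cs) S x ph@(uq , br , oks) t∈ s r≢t lx x≢t x∉S
    with image-edgeC t false u cs S br oks uq (root≢t ph t∈) (inj₂ s) r≢t
  ... | S′ , inj₂ s′ , corr , r = S′ , subst (OneSub S′) (sym (contract-as-edge t u cs)) s′ , corr , r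
  ... | S′ , inj₁ (_ , whole) , corr , r =
    ⊥-elim (x∉S (proj₁ corr x (subst (LeafIn x) (trans (contract-as-edge t u cs) whole) (contract-leaf⁺ (node u cs) x lx x≢t))))

-- 5. Moving separations across a contraction

open Separation

SeparationAvoiding : Tree → ℕ → ℕ → ℕ → Set
SeparationAvoiding T t x y = Σ (Separation T x y) λ s → rootId (sub s) ≢ t

module _ (t : ℕ) (T : Tree) (ph : Phylogenetic T) (t∈T : IsEdge t T) where

  pull : ∀ {x y} → Rel (contract t T) x y → SeparationAvoiding T t x y
  pull {x} {y} r with rel⇒separation (phylogenetic-unique _ (contract-phylogenetic t T ph)) r
  ... | separation lx′ S′ s′ ly′ x∉S′ with contract-origin t T S′ ph t∈T s′
  ...   | S , s , r≢t , (back , forth) =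
    separation (contract-leaf⁻ t T x ph lx′) S s (back y ly′)
      (λ x∈S → x∉S′ (forth x x∈S (leaf≢ (contract-removes t T ph t∈T) lx′))) , r≢t

  push : ∀ {x y} → (s : SeparationAvoiding T t x y) → x ≢ t → y ≢ t →
         Σ (Separation (contract t T) x y) λ s′ → rootId (sub s′) ≡ rootId (sub (proj₁ s)) ⊎ LeafIn t T
  push {x} {y} (separation lx S s ly x∉S , r≢t) x≢t y≢t
    with contract-image t T S x ph t∈T s r≢t lx x≢t x∉S
  ... | S′ , s′ , (back , forth) , r =
    separation (contract-leaf⁺ t T x lx x≢t) S′ s′ (forth y ly y≢t) (λ x∈S′ → x∉S (back x x∈S′)) , r

rel-contract-≢ : ∀ t T {x y} → Phylogenetic T → IsEdge t T → Rel (contract t T) x y → x ≢ t × y ≢ t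
rel-contract-≢ t T ph t∈T r with rel-leaves r
... | lx , ly = leaf≢ (contract-removes t T ph t∈T) lx , leaf≢ (contract-removes t T ph t∈T) ly

-- 6. Nested separating 1-edges

Nested : Tree → Tree → ℕ → Set
Nested S₃ S₁ x = S₃ ≡ S₁ ⊎ OneSub S₃ S₁ ⊎ (LeafIn x S₃ × OneSub S₁ S₃)

SiblingWitness : Tree → Tree → ℕ → Set
SiblingWitness T S₁ y = Σ ℕ λ x → LeafIn x T × ¬ LeafIn x S₁ × (∀ S₃ → OneSub S₃ T → LeafIn y S₃ → Nested S₃ S₁ x)

SiblingWitnessL : List Edge → Tree → ℕ → Set
SiblingWitnessL cs S₁ y = Σ ℕ λ x → LeafAmong x cs × ¬ LeafIn x S₁ × (∀ S₃ → OneSubL S₃ cs → LeafIn y S₃ → Nested S₃ S₁ x)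

any-ids : ∀ {Q : Edge → Set} {y xs} → Any Q xs → (∀ {e} → Q e → y ∈ ids (proj₂ e)) → y ∈ idsL xs
any-ids {xs = (_ , c) ∷ xs} (here q) f = ∈-++⁺ˡ (f q)
any-ids {xs = (_ , c) ∷ xs} (there a) f = ∈-++⁺ʳ (ids c) (any-ids a f)

unique-position : ∀ {Q : Edge → Set} {y} pre e post → Unique (idsL (pre ++ e ∷ post)) → y ∈ ids (proj₂ e) →
                  Any Q (pre ++ e ∷ post) → (∀ {e′} → Q e′ → y ∈ ids (proj₂ e′)) → Q e
unique-position pre e post u y∈e q f with subst Unique (idsL-++ pre (e ∷ post)) u | Any.++⁻ pre q
... | u′ | inj₁ q-pre = ⊥-elim (unique-disjoint (idsL pre) u′ (any-ids q-pre f) (∈-++⁺ˡ y∈e))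
... | u′ | inj₂ (here qe) = qe
... | u′ | inj₂ (there q-post) = ⊥-elim (unique-disjoint (ids (proj₂ e)) (unique-++ʳ (idsL pre) u′) y∈e (any-ids q-post f))

sibling-leaf : ∀ pre e post → Unique (idsL (pre ++ e ∷ post)) → Branching (pre ++ e ∷ post) →
               Σ ℕ λ z → LeafAmong z (pre ++ e ∷ post) × ¬ LeafIn z (proj₂ e)
sibling-leaf (p ∷ pre) e post u br with someLeaf (proj₂ p)
... | z , lz = z , here lz , (λ l → unique-disjoint (ids (proj₂ p)) u (leaf∈ids lz)
                 (subst (z ∈_) (sym (idsL-++ pre (e ∷ post))) (∈-++⁺ʳ (idsL pre) (∈-++⁺ˡ (leaf∈ids l)))))
sibling-leaf [] e (p ∷ post) u br with someLeaf (proj₂ p)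
... | z , lz = z , there (here lz) , (λ l → unique-disjoint (ids (proj₂ e)) u (leaf∈ids l) (∈-++⁺ˡ (leaf∈ids lz)))
sibling-leaf [] e [] u (inj₁ ())
sibling-leaf [] e [] u (inj₂ (s≤s ()))

all-at : ∀ {P : Edge → Set} pre e post → All P (pre ++ e ∷ post) → P e
all-at pre e post a with All.++⁻ʳ pre a
... | p ∷ _ = p

-- every 1-subtree S₁ containing y has a sibling witness: a leaf from a
-- sibling subtree of S₁ (which exists by the degree conditions)
mutual
  sibling-witness : ∀ T S₁ y → Phylogenetic T → OneSub S₁ T → LeafIn y S₁ → SiblingWitness T S₁ y
  sibling-witness (node u cs) S₁ y (_ ∷ uq , br , oks) (oneSub s) ly with sibling-witnessL S₁ y [] cs refl uq br oks s ly
  ... | x , lx , nx , nested = x , there lx , nx , (λ { S₃ (oneSub s₃) ly₃ → nested S₃ s₃ ly₃ })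

  -- the children cs ≡ pre ++ post are searched from post on
  sibling-witnessL : ∀ {cs} S₁ y pre post → cs ≡ pre ++ post → Unique (idsL cs) → Branching cs → All ChildOK cs →
                     OneSubL S₁ post → LeafIn y S₁ → SiblingWitnessL cs S₁ y
  sibling-witnessL S₁ y pre (e ∷ post) eq uq br oks (there s) ly =
    sibling-witnessL S₁ y (pre ++ e ∷ []) post (trans eq (sym (++-assoc pre (e ∷ []) post))) uq br oks s ly
  sibling-witnessL S₁ y pre ((b , c) ∷ post) refl uq br oks (here (inj₁ (_ , refl))) ly
    with sibling-leaf pre (b , c) post uq br
  ... | z , lz , nz = z , lz , nz , nested
    where
    nested : ∀ S₃ → OneSubL S₃ (pre ++ (b , c) ∷ post) → LeafIn y S₃ → Nested S₃ c z
    nested S₃ s₃ ly₃ with unique-position {Q = OneSubE S₃} pre (b , c) post uq (leaf∈ids ly) s₃ (λ q → leaf∈ids (oneSubE-leaf q ly₃))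
    ... | inj₁ (_ , refl) = inj₁ refl
    ... | inj₂ s₃′ = inj₂ (inj₁ s₃′)
  sibling-witnessL S₁ y pre ((b , c) ∷ post) refl uq br oks (here (inj₂ s₁)) ly
    with sibling-witness c S₁ y (innerOK⇒phylogenetic c (all-at pre (b , c) post oks) (unique-child pre (b , c) post uq)) s₁ ly
  ... | z , lzc , nz , nested-c = z , Any.++⁺ʳ pre (here lzc) , nz , nested
    where
    nested : ∀ S₃ → OneSubL S₃ (pre ++ (b , c) ∷ post) → LeafIn y S₃ → Nested S₃ S₁ z
    nested S₃ s₃ ly₃ with unique-position {Q = OneSubE S₃} pre (b , c) post uq (leaf∈ids (oneSub-leaf s₁ ly)) s₃
                            (λ q → leaf∈ids (oneSubE-leaf q ly₃))
    ... | inj₁ (_ , refl) = inj₂ (inj₂ (lzc , s₁))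
    ... | inj₂ s₃′ = nested-c S₃ s₃′ ly₃

oneSub⇒isEdge : ∀ {S T} → OneSub S T → IsEdge (rootId S) T
oneSub⇒isEdge s@(oneSub _) = oneSub-root∈ s

transfer : ∀ {T T′ X x y} → Explains T X → Explains T′ X → Rel T x y → Rel T′ x y
transfer {x = x} {y} ex ex′ r = Equivalence.to (ex′ x y) (Equivalence.from (ex x y) r)

-- If T and T_t explain the same relation, where t is the
-- child of a 1-edge above the leaf y, then a deeper 1-edge lies above y:
-- with x a sibling witness, (x,y) is related in T, hence in T_t, hence
-- separated in T by a 1-edge not into t, which must lie below the edge into t.
deeper : ∀ T X y (L : Tree) → Phylogenetic T → OneSub L T → LeafIn y L →
         Explains T X → Explains (contract (rootId L) T) X → Σ Tree λ W → OneSub W L × LeafIn y W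
deeper T X y L ph l ly exT exL with sibling-witness T L y ph l ly
... | x , lx , x∉L , nested
  with pull (rootId L) T ph (oneSub⇒isEdge l) (transfer exT exL (separation⇒rel (separation lx L l ly x∉L)))
... | separation _ S₃ s₃ ly₃ x∉S₃ , r≢t with nested S₃ s₃ ly₃
... | inj₁ refl = ⊥-elim (r≢t refl)
... | inj₂ (inj₁ below) = S₃ , below , ly₃
... | inj₂ (inj₂ (x∈S₃ , _)) = ⊥-elim (x∉S₃ x∈S₃)

-- the key step applied to a separation s whose 1-subtree lies (weakly)
-- below a 1-subtree B: (x,y) is separated by an edge into neither root
-- (identifiers are distinct)
deeper-separation : ∀ T X {x y} (s : Separation T x y) {B} → Phylogenetic T →
                    Explains T X → Explains (contract (rootId (sub s)) T) X →
                    OneSub B T → (sub s ≡ B ⊎ OneSub (sub s) B) →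
                    Σ (Separation T x y) λ s′ → rootId (sub s′) ≢ rootId (sub s) × rootId (sub s′) ≢ rootId B
deeper-separation T X (separation lx A a ly x∉A) {B} ph exT exA b A⊑B with deeper T X _ A ph a ly exT exA
... | W , w , lyW =
  separation lx W (oneSub-trans w a) lyW (λ x∈W → x∉A (oneSub-leaf w x∈W)) ,
  oneSub-root≢ w (oneSub-unique a uq) , oneSub-root≢ (below-B A⊑B) (oneSub-unique b uq)
  where
  uq = phylogenetic-unique T ph
  below-B : (A ≡ B ⊎ OneSub A B) → OneSub W B
  below-B (inj₁ refl) = w
  below-B (inj₂ A⊏B) = oneSub-trans w A⊏B

swap-conditions : ∀ {A : Set} {B C : A → Set} → Σ A (λ a → B a × C a) → Σ A (λ a → C a × B a)
swap-conditions (a , b , c) = a , c , b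

-- If T, T_e and T_f explain X, a pair of X separated in T avoiding e and
-- (another separation) avoiding f has a separation avoiding both: when the
-- first edge leads to f and the second to e, they are nested, and the
-- lower of the two can be pushed deeper by the key step.
separation-avoiding-both : ∀ T X e f {x y} → Phylogenetic T →
    Explains T X → Explains (contract e T) X → Explains (contract f T) X →
    SeparationAvoiding T e x y → SeparationAvoiding T f x y →
    Σ (Separation T x y) λ s → rootId (sub s) ≢ e × rootId (sub s) ≢ f
separation-avoiding-both T X e f {x} {y} ph exT exE exF (s₁ , r₁≢e) (s₂ , r₂≢f)
  with rootId (sub s₁) ≟ f | rootId (sub s₂) ≟ e
... | no r₁≢f | _ = s₁ , r₁≢e , r₁≢f
... | yes _ | no r₂≢e = s₂ , r₂≢e , r₂≢f
... | yes refl | yes refl with sibling-witness T (sub s₁) y ph (1sub s₁) (y∈S s₁)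
... | _ , _ , _ , nested with nested (sub s₂) (1sub s₂) (y∈S s₂)
... | inj₁ S₂≡S₁ = swap-conditions (deeper-separation T X s₁ ph exT exF (1sub s₂) (inj₁ (sym S₂≡S₁)))
... | inj₂ (inj₂ (_ , S₁⊏S₂)) = swap-conditions (deeper-separation T X s₁ ph exT exF (1sub s₂) (inj₂ S₁⊏S₂))
... | inj₂ (inj₁ S₂⊏S₁) = deeper-separation T X s₂ ph exT exE (1sub s₁) (inj₂ S₂⊏S₁)

-- If the contracted edge ends in a leaf e and T, T_e explain X, then X is
-- empty: a separation of (x,y) in T would relate x to e or e to y, but e
-- is not a leaf of T_e.
leaf-contraction-empty : ∀ T X e {x y} → Phylogenetic T → IsEdge e T → LeafIn e T →
                         Explains T X → Explains (contract e T) X → ¬ X x y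
leaf-contraction-empty T X e {x} {y} ph e∈T le exT exE xy
  with rel⇒separation (phylogenetic-unique T ph) (Equivalence.to (exT x y) xy)
... | separation lx S s ly x∉S = not-not-e∈S not-e∈S
  where
  e∉Tₑ : ∀ {z} → LeafIn z (contract e T) → z ≢ e
  e∉Tₑ = leaf≢ (contract-removes e T ph e∈T)
  not-e∈S : ¬ LeafIn e S
  not-e∈S e∈S = e∉Tₑ (proj₂ (rel-leaves (transfer exT exE (separation⇒rel (separation lx S s e∈S x∉S))))) refl
  not-not-e∈S : ¬ ¬ LeafIn e S
  not-not-e∈S e∉S = e∉Tₑ (proj₁ (rel-leaves (transfer exT exE (separation⇒rel (separation le S s ly e∉S))))) refl

lemma9 : (T : Tree) (X : ℕ → ℕ → Set) (e f : ℕ) →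
         Phylogenetic T → IsEdge e T → IsEdge f T →
         Explains T X → Explains (contract e T) X → Explains (contract f T) X →
         IsEdge f (contract e T) →
         Explains (contract f (contract e T)) X
lemma9 T X e f ph e∈T f∈T exT exE exF f∈Tₑ x y = mk⇔ forward backward
  where
  phₑ = contract-phylogenetic e T ph

  backward : Rel (contract f (contract e T)) x y → X x y
  backward r = Equivalence.from (exE x y) (separation⇒rel (proj₁ (pull f (contract e T) phₑ f∈Tₑ r)))

  forward : X x y → Rel (contract f (contract e T)) x y
  forward xy with rel-contract-≢ e T ph e∈T (Equivalence.to (exE x y) xy)
                | rel-contract-≢ f T ph f∈T (Equivalence.to (exF x y) xy)
  ... | x≢e , y≢e | x≢f , y≢f
    with separation-avoiding-both T X e f ph exT exE exF
           (pull e T ph e∈T (Equivalence.to (exE x y) xy)) (pull f T ph f∈T (Equivalence.to (exF x y) xy))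
  ... | s , r≢e , r≢f with push e T ph e∈T (s , r≢e) x≢e y≢e
  ... | sₑ , inj₂ e-leaf = ⊥-elim (leaf-contraction-empty T X e ph e∈T e-leaf exT exE xy)
  ... | sₑ , inj₁ same-root =
    separation⇒rel (proj₁ (push f (contract e T) phₑ f∈Tₑ (sₑ , λ r≡f → r≢f (trans (sym same-root) r≡f)) x≢f y≢f))
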